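{- Let $n\ge 2$ and $e=e_1\cdots e_n\in\mathbf{I}_n(0012)$ with $\textsc{srpt}(e)=\textsc{last}(e)=k$, where $0\le k\le n-2$. Then (a) $e_i=i-1$ for all $1\le i\le k+1$; (b) the sequence $e'=e'_1\cdots e'_{n-k}$ defined by $e'_i=e_{k+i}-k$ for $1\le i\le n-k$ belongs to $\mathbf{I}_{n-k}(0012)$ and satisfies $\textsc{srpt}(e')=\textsc{last}(e')=0$.
   Context: An inversion sequence of length $n$ is a sequence $e=e_1\cdots e_n$ of integers with $0\le e_i\le i-1$. The reduction of a word replaces each occurrence of the $k$-th smallest distinct entry by $k-1$; $e$ contains a pattern $p$ if some subsequence (entries at increasing positions) has reduction $p$, and avoids $p$ otherwise. $\mathbf{I}_m(0012)$ is the set of inversion sequences of length $m$ avoiding $0012$. For $e\in\mathbf{I}_m(0012)$, $\mathcal{R}(e)$ is the set of values appearing at least twice in $e$, $\textsc{srpt}(e)=\min\mathcal{R}(e)$ with the convention $\textsc{srpt}(01\cdots(m-1))=m-1$, and $\textsc{last}(e)=e_m$. -}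

module Defs where

open import Data.Nat using (ℕ; zero; suc; _≤_; _<_; _∸_; _≟_)
open import Data.Fin using (Fin; toℕ; fromℕ)
open import Data.Fin.Properties using (any?)
open import Data.List using (List; length; filter; upTo)
open import Data.Vec using (Vec; lookup; _∷_; [])
open import Data.Product using (Σ; ∃; _×_; _,_)
open import Data.Sum using (_⊎_)
open import Relation.Binary.PropositionalEquality using (_≡_; _≢_)
open import Relation.Nullary using (¬_)

-- A word of length n is a function Fin n → ℕ; position i (0-based) is
-- the paper's position toℕ i + 1.
Word : ℕ → Set
Word n = Fin n → ℕ

IsInvSeq : {n : ℕ} → Word n → Set
IsInvSeq {n} e = (i : Fin n) → e i ≤ toℕ i

-- Reduction: each entry is replaced by the number of distinct entries
-- of the word that are strictly smaller than it (so the k-th smallest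
-- distinct entry becomes k - 1).
reduction : {k : ℕ} → Word k → Word k
reduction {k} w a =
  length (filter (λ v → any? (λ j → w j ≟ v)) (upTo (w a)))

StrictlyIncreasing : {k n : ℕ} → (Fin k → Fin n) → Set
StrictlyIncreasing {k} σ = (a b : Fin k) → toℕ a < toℕ b → toℕ (σ a) < toℕ (σ b)

Contains : {k n : ℕ} → Word k → Word n → Set
Contains {k} {n} p e =
  Σ (Fin k → Fin n) λ σ → StrictlyIncreasing σ ×
    ((a : Fin k) → reduction (λ b → e (σ b)) a ≡ p a)

Avoids : {k n : ℕ} → Word k → Word n → Set
Avoids p e = ¬ Contains p e

p0012 : Word 4
p0012 = lookup (0 ∷ 0 ∷ 1 ∷ 2 ∷ [])

InI0012 : {n : ℕ} → Word n → Set
InI0012 e = IsInvSeq e × Avoids p0012 e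

InR : {n : ℕ} → Word n → ℕ → Set
InR {n} e v = Σ (Fin n) λ i → Σ (Fin n) λ j → i ≢ j × e i ≡ v × e j ≡ v

-- srpt(e) = k : k = min R(e), with the convention srpt(01⋯(n-1)) = n - 1.
Srpt : {n : ℕ} → Word n → ℕ → Set
Srpt {n} e k =
  (InR e k × ((v : ℕ) → InR e v → k ≤ v))
  ⊎ (((i : Fin n) → e i ≡ toℕ i) × k ≡ n ∸ 1)

-- last(e) = e_n (words of length 0 have no last entry; value 0 there is
-- a dummy and is never used below since all lengths are ≥ 2).
last : {n : ℕ} → Word n → ℕ
last {zero} e = 0
last {suc m} e = e (fromℕ m)

module Submission where

-- If k is a lower bound of the repeated values of an inversion sequence e, an entry e_i < i - 1
-- with i ≤ k + 1 would reappear at position e_i + 1 (inductively a fixed point), so the first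
-- k + 1 entries are 0, 1, …, k; for the same reason no later entry is below k. Hence subtracting
-- k from the suffix starting at position k + 1 gives an inversion sequence whose subsequences
-- have the same reductions as before, and whose first and last entries are both 0.

open import Defs
open import Data.Nat using (ℕ; zero; suc; _+_; _∸_; _≤_; _<_; _≟_; z≤n; s≤s)
open import Data.Nat.Properties
open import Data.Nat.Induction using (<-rec)
open import Data.Fin using (Fin; toℕ; fromℕ; fromℕ<; _↑ʳ_) renaming (zero to fzero)
open import Data.Fin.Properties using (toℕ<n; toℕ-↑ʳ; toℕ-fromℕ; toℕ-fromℕ<; toℕ-injective; any?)
open import Data.List using (length; filter; applyUpTo; upTo)
open import Data.List.Properties using (filter-reject; filter-≐)
open import Data.Product using (_×_; _,_; ∃)
open import Data.Sum using (inj₁; inj₂)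
open import Data.Empty using (⊥-elim)
open import Relation.Nullary using (¬_; yes; no)
open import Relation.Unary using (Decidable)
open import Function using (_∘_)
open import Relation.Binary.PropositionalEquality

private
  variable
    k m n : ℕ

module _ {P Q : ℕ → Set} (P? : Decidable P) (Q? : Decidable Q) where

  length-filter-applyUpTo : (f g : ℕ → ℕ) → (∀ i → P (f i) → Q (g i)) → (∀ i → Q (g i) → P (f i)) →
    ∀ n → length (filter P? (applyUpTo f n)) ≡ length (filter Q? (applyUpTo g n))
  length-filter-applyUpTo f g P⇒Q Q⇒P zero = refl
  length-filter-applyUpTo f g P⇒Q Q⇒P (suc n) with P? (f 0) | Q? (g 0)
  ... | yes _ | yes _ = cong suc (length-filter-applyUpTo _ _ (λ i → P⇒Q (suc i)) (λ i → Q⇒P (suc i)) n)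
  ... | yes p | no ¬q = ⊥-elim (¬q (P⇒Q 0 p))
  ... | no ¬p | yes q = ⊥-elim (¬p (Q⇒P 0 q))
  ... | no _  | no _  = length-filter-applyUpTo _ _ (λ i → P⇒Q (suc i)) (λ i → Q⇒P (suc i)) n

filter-applyUpTo-+ : {P : ℕ → Set} (P? : Decidable P) (f : ℕ → ℕ) → (∀ i → i < k → ¬ P (f i)) →
  ∀ n → filter P? (applyUpTo f (k + n)) ≡ filter P? (applyUpTo (λ i → f (k + i)) n)
filter-applyUpTo-+ {zero}  P? f ¬P n = refl
filter-applyUpTo-+ {suc k} P? f ¬P n =
  trans (filter-reject P? (¬P 0 (s≤s z≤n)))
        (filter-applyUpTo-+ P? (λ i → f (suc i)) (λ i i<k → ¬P (suc i) (s≤s i<k)) n)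

reduction-cong : {v w : Word m} → (∀ b → v b ≡ w b) → ∀ a → reduction v a ≡ reduction w a
reduction-cong {v = v} {w} v≗w a = begin
  length (filter Pv? (upTo (v a))) ≡⟨ cong (λ x → length (filter Pv? (upTo x))) (v≗w a) ⟩
  length (filter Pv? (upTo (w a))) ≡⟨ cong length (filter-≐ Pv? Pw? (v⇒w , w⇒v) (upTo (w a))) ⟩
  length (filter Pw? (upTo (w a))) ∎
  where
  open ≡-Reasoning
  Pv? : Decidable (λ x → ∃ λ j → v j ≡ x)
  Pv? x = any? (λ j → v j ≟ x)
  Pw? : Decidable (λ x → ∃ λ j → w j ≡ x)
  Pw? x = any? (λ j → w j ≟ x)
  v⇒w : ∀ {x} → ∃ (λ j → v j ≡ x) → ∃ (λ j → w j ≡ x)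
  v⇒w (j , eq) = j , trans (sym (v≗w j)) eq
  w⇒v : ∀ {x} → ∃ (λ j → w j ≡ x) → ∃ (λ j → v j ≡ x)
  w⇒v (j , eq) = j , trans (v≗w j) eq

reduction-+ : (k : ℕ) (w : Word m) → ∀ a → reduction (λ b → k + w b) a ≡ reduction w a
reduction-+ k w a = begin
  length (filter P? (applyUpTo (λ i → i) (k + w a)))
    ≡⟨ cong length (filter-applyUpTo-+ P? (λ i → i) unattained (w a)) ⟩
  length (filter P? (applyUpTo (k +_) (w a)))
    ≡⟨ length-filter-applyUpTo P? Q? (k +_) (λ i → i) cancel uncancel (w a) ⟩
  length (filter Q? (upTo (w a))) ∎
  where
  open ≡-Reasoning
  P? : Decidable (λ x → ∃ λ j → k + w j ≡ x)
  P? x = any? (λ j → k + w j ≟ x)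
  Q? : Decidable (λ x → ∃ λ j → w j ≡ x)
  Q? x = any? (λ j → w j ≟ x)
  unattained : ∀ i → i < k → ¬ ∃ (λ j → k + w j ≡ i)
  unattained i i<k (j , eq) = <⇒≱ i<k (subst (k ≤_) eq (m≤m+n k (w j)))
  cancel : ∀ i → ∃ (λ j → k + w j ≡ k + i) → ∃ (λ j → w j ≡ i)
  cancel i (j , eq) = j , +-cancelˡ-≡ k _ _ eq
  uncancel : ∀ i → ∃ (λ j → w j ≡ i) → ∃ (λ j → k + w j ≡ k + i)
  uncancel i (j , eq) = j , cong (k +_) eq

reduction-∸ : (k : ℕ) (w : Word m) → (∀ b → k ≤ w b) → ∀ a → reduction (λ b → w b ∸ k) a ≡ reduction w a
reduction-∸ k w k≤w a = begin
  reduction (λ b → w b ∸ k) a       ≡⟨ reduction-+ k (λ b → w b ∸ k) a ⟨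
  reduction (λ b → k + (w b ∸ k)) a ≡⟨ reduction-cong (λ b → m+[n∸m]≡n (k≤w b)) a ⟩
  reduction w a                     ∎
  where open ≡-Reasoning

suffix : (k : ℕ) → Word (k + m) → Word m
suffix k e i = e (k ↑ʳ i)

lower : ℕ → Word m → Word m
lower k w i = w i ∸ k

IsInvSeq-lower-suffix : {e : Word (k + m)} → IsInvSeq e → IsInvSeq (lower k (suffix k e))
IsInvSeq-lower-suffix {k} {e = e} inv i =
  subst (e (k ↑ʳ i) ∸ k ≤_) (m+n∸m≡n k (toℕ i))
        (∸-monoˡ-≤ k (subst (e (k ↑ʳ i) ≤_) (toℕ-↑ʳ k i) (inv (k ↑ʳ i))))

Avoids-suffix : {p : Word n} {e : Word (k + m)} → Avoids p e → Avoids p (suffix k e)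
Avoids-suffix {k = k} avoid (σ , σ-inc , red) = avoid ((k ↑ʳ_) ∘ σ , inc , red)
  where
  inc : StrictlyIncreasing (λ b → k ↑ʳ σ b)
  inc a b a<b rewrite toℕ-↑ʳ k (σ a) | toℕ-↑ʳ k (σ b) = +-monoʳ-< k (σ-inc a b a<b)

Avoids-lower : {p : Word n} {w : Word m} → (∀ i → k ≤ w i) → Avoids p w → Avoids p (lower k w)
Avoids-lower {k = k} {w = w} k≤w avoid (σ , σ-inc , red) =
  avoid (σ , σ-inc , λ a → trans (sym (reduction-∸ k (w ∘ σ) (k≤w ∘ σ) a)) (red a))

last-suffix : (e : Word (k + suc m)) → last (suffix k e) ≡ last e
last-suffix {k} {m} e = sym (last-at (k + suc m) (k ↑ʳ fromℕ m) position)
  where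
  last-at : ∀ n {e : Word n} (i : Fin n) → suc (toℕ i) ≡ n → last e ≡ e i
  last-at (suc n) {e} i eq = cong e (toℕ-injective (trans (toℕ-fromℕ n) (sym (suc-injective eq))))
  position : suc (toℕ (k ↑ʳ fromℕ m)) ≡ k + suc m
  position = begin
    suc (toℕ (k ↑ʳ fromℕ m)) ≡⟨ cong suc (toℕ-↑ʳ k (fromℕ m)) ⟩
    suc (k + toℕ (fromℕ m))  ≡⟨ cong (λ x → suc (k + x)) (toℕ-fromℕ m) ⟩
    suc (k + m)              ≡⟨ +-suc k m ⟨
    k + suc m                ∎
    where open ≡-Reasoning

Repeats≥ : Word n → ℕ → Set
Repeats≥ e k = ∀ v → InR e v → k ≤ v

Srpt⇒Repeats≥ : (e : Word n) → suc k < n → Srpt e k → Repeats≥ e k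
Srpt⇒Repeats≥ e k+1<n (inj₁ (_ , minimal)) = minimal
Srpt⇒Repeats≥ {suc n} e k+1<n (inj₂ (_ , refl)) = ⊥-elim (<-irrefl refl k+1<n)

InR-if-fixed-below : (e : Word n) (p : Fin n) → e p < toℕ p →
  (∀ j → toℕ j ≡ e p → e j ≡ e p) → InR e (e p)
InR-if-fixed-below {n} e p ep<p fixed = j , p , j≢p , fixed j j≡ep , refl
  where
  j : Fin n
  j = fromℕ< (<-trans ep<p (toℕ<n p))
  j≡ep : toℕ j ≡ e p
  j≡ep = toℕ-fromℕ< _
  j≢p : j ≢ p
  j≢p j≡p = <-irrefl (trans (sym j≡ep) (cong toℕ j≡p)) ep<p

module _ {e : Word n} (inv : IsInvSeq e) (repeats≥k : Repeats≥ e k) where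

  prefix-identity : (i : Fin n) → toℕ i ≤ k → e i ≡ toℕ i
  prefix-identity i = <-rec Identity step (toℕ i) i refl
    where
    Identity : ℕ → Set
    Identity t = ∀ i → toℕ i ≡ t → toℕ i ≤ k → e i ≡ toℕ i
    step : ∀ t → (∀ {s} → s < t → Identity s) → Identity t
    step t ih i refl i≤k with m≤n⇒m<n∨m≡n (inv i)
    ... | inj₂ ei≡i = ei≡i
    ... | inj₁ ei<i = ⊥-elim (<⇒≱ ei<i (≤-trans i≤k (repeats≥k (e i) repeated)))
      where
      fixed : ∀ j → toℕ j ≡ e i → e j ≡ e i
      fixed j j≡ei = trans (ih ei<i j j≡ei (≤-trans (≤-trans (≤-reflexive j≡ei) (<⇒≤ ei<i)) i≤k)) j≡ei
      repeated : InR e (e i)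
      repeated = InR-if-fixed-below e i ei<i fixed

  suffix-≥ : (p : Fin n) → k ≤ toℕ p → k ≤ e p
  suffix-≥ p k≤p with k ≤? e p
  ... | yes k≤ep = k≤ep
  ... | no k≰ep = ⊥-elim (k≰ep (repeats≥k (e p) (InR-if-fixed-below e p ep<p fixed)))
    where
    ep<k : e p < k
    ep<k = ≰⇒> k≰ep
    ep<p : e p < toℕ p
    ep<p = <-≤-trans ep<k k≤p
    fixed : ∀ j → toℕ j ≡ e p → e j ≡ e p
    fixed j j≡ep = trans (prefix-identity j (≤-trans (≤-reflexive j≡ep) (<⇒≤ ep<k))) j≡ep

lemma2p4 : (k m : ℕ) → 2 ≤ m → (e : Fin (k + m) → ℕ) →
    InI0012 e → Srpt e k → last e ≡ k →
    ((i : Fin (k + m)) → toℕ i ≤ k → e i ≡ toℕ i)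
    × (InI0012 (λ (i : Fin m) → e (k ↑ʳ i) ∸ k)
       × Srpt (λ (i : Fin m) → e (k ↑ʳ i) ∸ k) 0
       × last (λ (i : Fin m) → e (k ↑ʳ i) ∸ k) ≡ 0)
lemma2p4 k m@(suc (suc m′)) 2≤m@(s≤s (s≤s z≤n)) e (inv , avoid) srpt last≡k =
  prefix , (IsInvSeq-lower-suffix inv , Avoids-lower suffix≥k (Avoids-suffix {e = e} avoid))
         , inj₁ ((fzero , fromℕ (suc m′) , (λ ()) , first′≡0 , last′≡0) , λ _ _ → z≤n)
         , last′≡0
  where
  repeats≥k : Repeats≥ e k
  repeats≥k = Srpt⇒Repeats≥ e (subst (_≤ k + m) (+-comm k 2) (+-monoʳ-≤ k 2≤m)) srpt
  prefix : (i : Fin (k + m)) → toℕ i ≤ k → e i ≡ toℕ i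
  prefix = prefix-identity inv repeats≥k
  suffix≥k : ∀ i → k ≤ suffix k e i
  suffix≥k i = suffix-≥ inv repeats≥k (k ↑ʳ i) (subst (k ≤_) (sym (toℕ-↑ʳ k i)) (m≤m+n k (toℕ i)))
  first′≡0 : lower k (suffix k e) fzero ≡ 0
  first′≡0 = trans (cong (_∸ k) (trans (prefix (k ↑ʳ fzero) (≤-reflexive position)) position)) (n∸n≡0 k)
    where
    position : toℕ (k ↑ʳ fzero {suc m′}) ≡ k
    position = trans (toℕ-↑ʳ k fzero) (+-identityʳ k)
  last′≡0 : last (lower k (suffix k e)) ≡ 0
  last′≡0 = trans (cong (_∸ k) (trans (last-suffix e) last≡k)) (n∸n≡0 k)
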